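{- Let $t$ be an integer, let $G$ be a $P_t$-free graph, and let $X,Y\subseteq V(G)$ be disjoint sets such that $X$ is stable and every connected component of $G|Y$ has at most $p$ vertices. Let $\mathcal{Z}$ be a set of subsets of $Y$, each of size $q$, each inducing a connected subgraph of $G$, and each having an attachment in $X$. Let $H$ be the hypergraph with vertex set $X$ and hyperedge set $\{X(Z): Z\in\mathcal{Z}\}$. Then $\lambda(H)\le \binom{p}{q}\left\lceil \frac{t+1}{2}\right\rceil$.
   Context: Graphs are finite and simple; $P_t$ is the path on $t$ vertices, and $G$ is $P_t$-free if it has no induced subgraph isomorphic to $P_t$. $G|A$ denotes the subgraph induced on $A$. A set is stable if no edge has both ends in it. For $A\subseteq V(G)$, an attachment of $A$ is a vertex of $V(G)\setminus A$ with a neighbor in $A$; for $B\subseteq V(G)\setminus A$, $B(A)$ denotes the set of attachments of $A$ that lie in $B$ (so $X(Z)$ is the set of vertices of $X$ having a neighbor in $Z$). A hypergraph $H$ consists of a finite vertex set $V(H)$ and a set $E(H)$ of nonempty subsets of $V(H)$ (hyperedges). $\lambda(H)$ is the maximum $k\ge 2$ such that there are hyperedges $e_1,\dots,e_k\in E(H)$ with the property that for every $1\le i<j\le k$ there is a vertex $v_{i,j}\in V(H)$ with $\{h\in\{1,\dots,k\}: v_{i,j}\in e_h\}=\{i,j\}$; if no such $k$ exists, $\lambda(H)=2$. -}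

module Defs where

open import Data.Nat using (ℕ; suc)
import Data.Nat
open import Data.Bool using (Bool; true; false)
open import Data.Fin using (Fin; toℕ; _<_)
open import Data.Fin.Subset using (Subset; _∈_; _∉_; _⊆_; ∣_∣)
open import Data.Product using (Σ; ∃; _×_; _,_)
open import Data.Sum using (_⊎_)
open import Data.Empty using (⊥)
open import Function using (_⇔_)
open import Function.Definitions using (Injective)
open import Relation.Binary.PropositionalEquality using (_≡_)

record Graph : Set where
  field
    n      : ℕ
    adj    : Fin n → Fin n → Bool
    sym    : ∀ u v → adj u v ≡ adj v u
    irrefl : ∀ v → adj v v ≡ false

open Graph public

Vtx : Graph → Set
Vtx G = Fin (n G)

VSet : Graph → Set
VSet G = Subset (n G)

Adj : (G : Graph) → Vtx G → Vtx G → Set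
Adj G u v = adj G u v ≡ true

HasInducedPath : (G : Graph) → ℕ → Set
HasInducedPath G t =
  Σ (Fin t → Vtx G) λ v →
    Injective _≡_ _≡_ v ×
    (∀ i j → Adj G (v i) (v j) ⇔ ((suc (toℕ i) ≡ toℕ j) ⊎ (suc (toℕ j) ≡ toℕ i)))

PathFree : ℕ → Graph → Set
PathFree t G = HasInducedPath G t → ⊥

Stable : (G : Graph) → VSet G → Set
Stable G S = ∀ u v → u ∈ S → v ∈ S → Adj G u v → ⊥

Disjoint : (G : Graph) → VSet G → VSet G → Set
Disjoint G A B = ∀ v → v ∈ A → v ∈ B → ⊥

data Reach (G : Graph) (S : VSet G) (u : Vtx G) : Vtx G → Set where
  here : u ∈ S → Reach G S u u
  step : ∀ {v w} → Reach G S u v → Adj G v w → w ∈ S → Reach G S u w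

Connected : (G : Graph) → VSet G → Set
Connected G S = ∀ u v → u ∈ S → v ∈ S → Reach G S u v

ComponentsAtMost : (G : Graph) → VSet G → ℕ → Set
ComponentsAtMost G Y p =
  ∀ y → y ∈ Y → (C : VSet G) → (∀ v → v ∈ C → Reach G Y y v) → ∣ C ∣ Data.Nat.≤ p

InAttach : (G : Graph) → VSet G → VSet G → Vtx G → Set
InAttach G X Z x = x ∈ X × ∃ λ z → z ∈ Z × Adj G x z

-- Z has an attachment in X (X disjoint from Z in our application).
HasAttachmentIn : (G : Graph) → VSet G → VSet G → Set
HasAttachmentIn G X Z = ∃ λ x → x ∉ Z × InAttach G X Z x

-- A witnessing family for λ(H) of size k, where H has vertex set X and
-- hyperedges {X(Z) : Z ∈ 𝒵}: hyperedges e_h = X(Z h) with Z h ∈ 𝒵, such that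
-- for all i < j some vertex v ∈ X lies in exactly e_i and e_j.
LambdaFamily : (G : Graph) → VSet G → (VSet G → Set) → (k : ℕ) → Set
LambdaFamily G X 𝒵 k =
  Σ (Fin k → VSet G) λ Z →
    (∀ h → 𝒵 (Z h)) ×
    (∀ (i j : Fin k) → i < j →
       ∃ λ v → v ∈ X × (∀ h → InAttach G X (Z h) v ⇔ (h ≡ i ⊎ h ≡ j)))

LambdaAtMost : (G : Graph) → VSet G → (VSet G → Set) → ℕ → Set
LambdaAtMost G X 𝒵 B = ∀ k → 2 Data.Nat.≤ k → LambdaFamily G X 𝒵 k → k Data.Nat.≤ B

-- Call two members of the family linked if they meet a common component of G|Y.  A component has
-- at most p vertices, so the members linked to a fixed one are at most p C q distinct q-subsets of
-- it; for k ≥ 3 the members are distinct, since a vertex exclusive to Z i and Z h cannot also attach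
-- to Z j.  Hence if k > (p C q) * m with m = ⌈(t+1)/2⌉, there are m + 1 pairwise unlinked members
-- Z a₀, …, Z aₘ.  Walk through Z a₀, a vertex exclusive to (a₀, a₁), Z a₁, …, Z aₘ and shortcut the
-- walk to an induced path.  The levels 2i on Z aᵢ and 2i + 1 on the exclusive vertices change by at
-- most one along an edge, because the members are unlinked and X is stable, so the path has at
-- least 2m + 1 ≥ t vertices.  Linkedness is not decidable without further work, but the bound is a
-- decidable statement and may therefore be proved under a double negation.  For k = 2 it suffices
-- that t ≥ 2, as G has a vertex.

module Submission where

open import Defs hiding (sym)

open import Data.Bool using (Bool; true; false)
import Data.Bool as Bool
open import Data.Empty using (⊥; ⊥-elim)
open import Data.Fin using (Fin; zero; suc; toℕ; inject≤)
import Data.Fin.Properties as Fin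
open import Data.Fin.Properties using (inject≤-injective; toℕ-inject≤; sequence)
open import Data.Fin.Subset using (Subset; _∈_; _⊆_; ∣_∣; ⋃; inside; outside)
open import Data.Fin.Subset.Properties using (drop-∷-⊆; p⊆p∪q; q⊆p∪q; x∈p∪q⁻; ∉⊥)
open import Data.List using (List; []; _∷_; _++_; length; map; filter; lookup; allFin)
open import Data.List.Properties using (∷-injectiveʳ; length-map; length-tabulate)
open import Data.List.Membership.Propositional using () renaming (_∈_ to _∈ˡ_)
open import Data.List.Membership.Propositional.Properties
  using (∈-filter⁻; ∈-lookup; ∈-map⁺; ∈-map⁻)
open import Data.List.Relation.Unary.All as All using (All; []; _∷_)
import Data.List.Relation.Unary.All.Properties as All
open import Data.List.Relation.Unary.All.Properties using (all-filter; ¬Any⇒All¬)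
open import Data.List.Relation.Unary.AllPairs using (AllPairs; []; _∷_)
open import Data.List.Relation.Unary.Any using (Any; here; there; any?)
open import Data.List.Relation.Unary.Unique.Propositional using (Unique)
import Data.List.Relation.Unary.Unique.Propositional.Properties as Unique
open import Data.Nat using (ℕ; zero; suc; _+_; _*_; _≤_; z≤n; s≤s; _≤?_; ⌈_/2⌉)
open import Data.Nat.Combinatorics using (_C_; nCk+nC[k+1]≡[n+1]C[k+1])
open import Data.Nat.Properties
  using ( ≤-refl; ≤-reflexive; ≤-trans; ≤-pred; ≰⇒>; n≤1+n; +-suc; +-identityʳ; +-mono-≤
        ; +-monoˡ-≤; *-suc; *-comm; *-mono-≤; suc-injective; ⌈n/2⌉-mono; module ≤-Reasoning)
open import Data.Product using (∃; _×_; _,_; proj₁; proj₂; map₂)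
open import Data.Sum using (_⊎_; inj₁; inj₂)
import Data.Sum as Sum
open import Data.Unit using (⊤; tt)
open import Data.Vec using ([]; _∷_; here)
open import Effect.Monad using (RawMonad)
open import Function using (id; _∘_; _⇔_; mk⇔; Equivalence)
open import Relation.Binary.Definitions using (tri<; tri≈; tri>)
open import Relation.Binary.PropositionalEquality
  using (_≡_; _≢_; refl; sym; cong; subst; subst₂; trans)
open import Relation.Nullary using (¬_; Dec; yes; no; contradiction)
open import Relation.Nullary.Decidable using (_⊎-dec_; ¬¬-excluded-middle; decidable-stable)
open import Relation.Nullary.Negation using (¬¬-Monad; ¬¬-map)
open import Relation.Unary.Properties using (∁?)

C-monoˡ-≤ : ∀ {m n} k → m ≤ n → m C k ≤ n C k
C-monoˡ-≤ {n = zero} k z≤n = ≤-refl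
C-monoˡ-≤ {zero} {suc n} zero z≤n = ≤-refl
C-monoˡ-≤ {zero} {suc n} (suc k) z≤n = z≤n
C-monoˡ-≤ {suc m} {suc n} zero (s≤s m≤n) = ≤-refl
C-monoˡ-≤ {suc m} {suc n} (suc k) (s≤s m≤n) =
  subst₂ _≤_ (nCk+nC[k+1]≡[n+1]C[k+1] m k) (nCk+nC[k+1]≡[n+1]C[k+1] n k)
    (+-mono-≤ (C-monoˡ-≤ k m≤n) (C-monoˡ-≤ (suc k) m≤n))

module _ {n : ℕ} where

  tailsWithHead : Bool → List (Subset (suc n)) → List (Subset n)
  tailsWithHead b [] = []
  tailsWithHead b ((c ∷ s) ∷ ss) with b Bool.≟ c
  ... | yes _ = s ∷ tailsWithHead b ss
  ... | no _  = tailsWithHead b ss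

  length-tailsWithHead : ∀ ss →
    length ss ≡ length (tailsWithHead true ss) + length (tailsWithHead false ss)
  length-tailsWithHead [] = refl
  length-tailsWithHead ((true ∷ s) ∷ ss) = cong suc (length-tailsWithHead ss)
  length-tailsWithHead ((false ∷ s) ∷ ss) =
    trans (cong suc (length-tailsWithHead ss)) (sym (+-suc _ _))

  All-tailsWithHead : ∀ {P : Subset (suc n) → Set} b {ss} →
    All P ss → All (λ s → P (b ∷ s)) (tailsWithHead b ss)
  All-tailsWithHead b [] = []
  All-tailsWithHead b {(c ∷ s) ∷ ss} (p ∷ ps) with b Bool.≟ c
  ... | yes refl = p ∷ All-tailsWithHead b ps
  ... | no _     = All-tailsWithHead b ps

  Unique-tailsWithHead : ∀ b {ss} → Unique ss → Unique (tailsWithHead b ss)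
  Unique-tailsWithHead b [] = []
  Unique-tailsWithHead b {(c ∷ s) ∷ ss} (s∉ss ∷ u) with b Bool.≟ c
  ... | yes refl =
    All.map (λ ne e → ne (cong (b ∷_) e)) (All-tailsWithHead b s∉ss) ∷ Unique-tailsWithHead b u
  ... | no _ = Unique-tailsWithHead b u

length≡0 : ∀ {A : Set} {xs : List A} → All (λ _ → ⊥) xs → length xs ≡ 0
length≡0 [] = refl

IsSubsetOfSize : ∀ {n} → Subset n → ℕ → Subset n → Set
IsSubsetOfSize D q S = S ⊆ D × ∣ S ∣ ≡ q

module _ {n} {D s : Subset n} {c : Bool} {q : ℕ} where

  IsSubsetOfSize-dropOutside : IsSubsetOfSize (c ∷ D) q (outside ∷ s) → IsSubsetOfSize D q s
  IsSubsetOfSize-dropOutside (⊆ , size) = drop-∷-⊆ ⊆ , size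

  IsSubsetOfSize-dropInside : IsSubsetOfSize (c ∷ D) (suc q) (inside ∷ s) → IsSubsetOfSize D q s
  IsSubsetOfSize-dropInside (⊆ , size) = drop-∷-⊆ ⊆ , suc-injective size

-- Split the subsets by their first coordinate: this is Pascal's rule.
length-subsets≤C : ∀ {n} q (D : Subset n) {Ss : List (Subset n)} →
  Unique Ss → All (IsSubsetOfSize D q) Ss → length Ss ≤ ∣ D ∣ C q
length-subsets≤C q [] [] _ = z≤n
length-subsets≤C zero [] ([] ∷ []) _ = ≤-refl
length-subsets≤C zero [] {[] ∷ [] ∷ _} ((S≢S′ ∷ _) ∷ _) _ = ⊥-elim (S≢S′ refl)
length-subsets≤C (suc q) [] {[] ∷ _} _ ((_ , ()) ∷ _)
length-subsets≤C {suc n} q (d ∷ D) {Ss} u Ss⊆ = begin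
  length Ss                                    ≡⟨ length-tailsWithHead Ss ⟩
  length withTrue + length withFalse           ≤⟨ +-mono-≤ ≤-refl withFalse≤ ⟩
  length withTrue + ∣ D ∣ C q                   ≤⟨ pascal d q (Unique-tailsWithHead true u)
                                                     (All-tailsWithHead true Ss⊆) ⟩
  ∣ d ∷ D ∣ C q                                  ∎
  where
    open ≤-Reasoning

    withTrue withFalse : List (Subset n)
    withTrue = tailsWithHead true Ss
    withFalse = tailsWithHead false Ss

    withFalse≤ : length withFalse ≤ ∣ D ∣ C q
    withFalse≤ = length-subsets≤C q D (Unique-tailsWithHead false u)
      (All.map IsSubsetOfSize-dropOutside (All-tailsWithHead false Ss⊆))

    pascal : ∀ d q {ts} → Unique ts → All (λ s → IsSubsetOfSize (d ∷ D) q (true ∷ s)) ts →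
             length ts + ∣ D ∣ C q ≤ ∣ d ∷ D ∣ C q
    pascal outside q _ ts⊆
      rewrite length≡0 (All.map (λ (⊆ , _) → contradiction (⊆ here) λ ()) ts⊆) = ≤-refl
    pascal inside zero _ ts⊆ rewrite length≡0 (All.map (λ ()) ts⊆) = ≤-refl
    pascal inside (suc q) {ts} u ts⊆ =
      subst (length ts + ∣ D ∣ C suc q ≤_) (nCk+nC[k+1]≡[n+1]C[k+1] ∣ D ∣ q)
        (+-mono-≤ (length-subsets≤C q D u (All.map IsSubsetOfSize-dropInside ts⊆)) ≤-refl)

⊆-⋃ : ∀ {n} {S : Subset n} {Ss} → S ∈ˡ Ss → S ⊆ ⋃ Ss
⊆-⋃ {Ss = S ∷ Ss} (here refl) = p⊆p∪q (⋃ Ss)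
⊆-⋃ {Ss = S ∷ Ss} (there S∈Ss) = q⊆p∪q S (⋃ Ss) ∘ ⊆-⋃ S∈Ss

∈-⋃⁻ : ∀ {n} {x : Fin n} Ss → x ∈ ⋃ Ss → ∃ λ S → S ∈ˡ Ss × x ∈ S
∈-⋃⁻ [] x∈∅ = contradiction x∈∅ ∉⊥
∈-⋃⁻ (S ∷ Ss) x∈ with x∈p∪q⁻ S (⋃ Ss) x∈
... | inj₁ x∈S = S , here refl , x∈S
... | inj₂ x∈⋃ with ∈-⋃⁻ Ss x∈⋃
...   | S′ , S′∈ , x∈S′ = S′ , there S′∈ , x∈S′

length-filter+length-filter-∁ : ∀ {A : Set} {P : A → Set} (P? : ∀ x → Dec (P x)) xs →
  length (filter P? xs) + length (filter (∁? P?) xs) ≡ length xs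
length-filter+length-filter-∁ P? [] = refl
length-filter+length-filter-∁ P? (x ∷ xs) with P? x
... | yes _ = cong suc (length-filter+length-filter-∁ P? xs)
... | no _  = trans (+-suc _ _) (cong suc (length-filter+length-filter-∁ P? xs))

Antichain : ∀ {A : Set} → (A → A → Set) → List A → Set
Antichain R = AllPairs (λ a b → ¬ R a b)

module _ {A : Set} {R : A → A → Set} (R? : ∀ a b → Dec (R a b)) where

  antichain-or-bounded : ∀ c m (L : List A) → Unique L →
    (∀ a S → Unique S → All (R a) S → length S ≤ c) →
    (∃ λ As → All (_∈ˡ L) As × Antichain R As × length As ≡ suc m) ⊎ length L ≤ m * c
  antichain-or-bounded c m [] _ _ = inj₂ z≤n
  antichain-or-bounded c zero (x ∷ L) _ _ = inj₁ (x ∷ [] , here refl ∷ [] , [] ∷ [] , refl)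
  antichain-or-bounded c (suc m) L@(x ∷ _) u classes≤c
    with antichain-or-bounded c m (filter (∁? (R? x)) L) (Unique.filter⁺ (∁? (R? x)) u) classes≤c
  ... | inj₁ (As , As⊆ , anti , len) =
    inj₁ ( x ∷ As
         , here refl ∷ All.map (proj₁ ∘ ∈-filter⁻ (∁? (R? x))) As⊆
         , All.map (proj₂ ∘ ∈-filter⁻ (∁? (R? x))) As⊆ ∷ anti
         , cong suc len)
  ... | inj₂ rest≤ = inj₂ (begin
    length L                                                  ≡⟨ length≡ ⟩
    length (filter (R? x) L) + length (filter (∁? (R? x)) L)  ≤⟨ +-mono-≤ class≤ rest≤ ⟩
    c + m * c                                                 ∎)
    where
      open ≤-Reasoning
      length≡ = sym (length-filter+length-filter-∁ (R? x) L)
      class≤ = classes≤c x (filter (R? x) L) (Unique.filter⁺ (R? x) u) (all-filter (R? x) L)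

module GraphWalks (G : Graph) where

  Adj-sym : ∀ {u v} → Adj G u v → Adj G v u
  Adj-sym {u} {v} = trans (Graph.sym G v u)

  Adj-irrefl : ∀ {u} → ¬ Adj G u u
  Adj-irrefl {u} uu with trans (sym uu) (irrefl G u)
  ... | ()

  Reach-trans : ∀ {S u v w} → Reach G S u v → Reach G S v w → Reach G S u w
  Reach-trans u⇝v (here _) = u⇝v
  Reach-trans u⇝v (step v⇝w e w∈S) = step (Reach-trans u⇝v v⇝w) e w∈S

  Reach-mono : ∀ {S T u v} → S ⊆ T → Reach G S u v → Reach G T u v
  Reach-mono S⊆T (here u∈S) = here (S⊆T u∈S)
  Reach-mono S⊆T (step r e w∈S) = step (Reach-mono S⊆T r) e (S⊆T w∈S)

  Walk : Vtx G → List (Vtx G) → Set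
  Walk u [] = ⊤
  Walk u (w ∷ ws) = Adj G u w × Walk w ws

  end : Vtx G → List (Vtx G) → Vtx G
  end u [] = u
  end u (w ∷ ws) = end w ws

  end-++ : ∀ u xs w ws → end u (xs ++ w ∷ ws) ≡ end w ws
  end-++ u [] w ws = refl
  end-++ u (x ∷ xs) w ws = end-++ x xs w ws

  Walk-++ : ∀ {u w} xs {ws} → Walk u xs → Adj G (end u xs) w → Walk w ws → Walk u (xs ++ w ∷ ws)
  Walk-++ [] _ uw walk = uw , walk
  Walk-++ (x ∷ xs) (ux , walk₁) e walk₂ = ux , Walk-++ xs walk₁ e walk₂

  reach⇒walk : ∀ {S u v} → Reach G S u v → ∃ λ ws → Walk u ws × All (_∈ S) ws × end u ws ≡ v
  reach⇒walk (here _) = [] , tt , [] , refl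
  reach⇒walk {u = u} (step {w = w} r e w∈S) with reach⇒walk r
  ... | ws , walk , ws⊆S , refl =
    ws ++ w ∷ [] , Walk-++ ws walk e tt , All.++⁺ ws⊆S (w∈S ∷ []) , end-++ u ws w []

  IsInducedPath : Vtx G → List (Vtx G) → Set
  IsInducedPath u [] = ⊤
  IsInducedPath u (w ∷ ws) =
    All (u ≢_) (w ∷ ws) × Adj G u w × All (¬_ ∘ Adj G u) ws × IsInducedPath w ws

  IsInducedPath⇒Walk : ∀ {u} ps → IsInducedPath u ps → Walk u ps
  IsInducedPath⇒Walk [] _ = tt
  IsInducedPath⇒Walk (w ∷ ps) (_ , uw , _ , path) = uw , IsInducedPath⇒Walk ps path

  IsInducedPath-suffix : ∀ xs {u ps y ys} →
    IsInducedPath u ps → u ∷ ps ≡ xs ++ y ∷ ys → IsInducedPath y ys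
  IsInducedPath-suffix [] path refl = path
  IsInducedPath-suffix (x ∷ xs) {ps = p ∷ ps} (_ , _ , _ , path) eq =
    IsInducedPath-suffix xs path (∷-injectiveʳ eq)
  IsInducedPath-suffix (x ∷ []) {ps = []} _ ()
  IsInducedPath-suffix (x ∷ _ ∷ _) {ps = []} _ ()

  Near : Vtx G → Vtx G → Set
  Near u z = z ≡ u ⊎ Adj G u z

  near? : ∀ u z → Dec (Near u z)
  near? u z = (z Fin.≟ u) ⊎-dec (adj G u z Bool.≟ true)

  lastNear : ∀ u zs → Any (Near u) zs →
    ∃ λ xs → ∃ λ y → ∃ λ ys → zs ≡ xs ++ y ∷ ys × Near u y × All (¬_ ∘ Near u) ys
  lastNear u (z ∷ zs) near with any? (near? u) zs
  ... | yes near′ with lastNear u zs near′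
  ...   | xs , y , ys , refl , uy , far = z ∷ xs , y , ys , refl , uy , far
  lastNear u (z ∷ zs) (here uz) | no far = [] , z , zs , refl , uz , ¬Any⇒All¬ zs far
  lastNear u (z ∷ zs) (there near′) | no far = contradiction near′ far

  -- Make the rest of the walk induced first, then let u jump to the last vertex of it that is u
  -- itself or a neighbour of u.
  walk⇒inducedPath : ∀ (Q : Vtx G → Set) u ws → Walk u ws → All Q ws →
    ∃ λ ps → IsInducedPath u ps × end u ps ≡ end u ws × All Q ps
  walk⇒inducedPath Q u [] _ _ = [] , tt , refl , []
  walk⇒inducedPath Q u (w ∷ ws) (uw , walk) (qw ∷ qws)
    with walk⇒inducedPath Q w ws walk qws
  ... | ps , path , end≡ , qps
    with lastNear u (w ∷ ps) (here (inj₂ uw))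
  ...   | xs , y , ys , split , near , far = jumpTo near
    where
      path′ : IsInducedPath y ys
      path′ = IsInducedPath-suffix xs path split

      end′ : end y ys ≡ end w ws
      end′ = trans (sym (trans (cong (end u) split) (end-++ u xs y ys))) end≡

      qys : All Q (y ∷ ys)
      qys = All.++⁻ʳ xs (subst (All Q) split (qw ∷ qps))

      u≢y : Adj G u y → u ≢ y
      u≢y uy u≡y = Adj-irrefl (subst (Adj G u) (sym u≡y) uy)

      jumpTo : Near u y → ∃ λ ps → IsInducedPath u ps × end u ps ≡ end w ws × All Q ps
      jumpTo (inj₁ y≡u) =
        ys , subst (λ v → IsInducedPath v ys) y≡u path′ ,
        subst (λ v → end v ys ≡ end w ws) y≡u end′ , All.tail qys
      jumpTo (inj₂ uy) =
        y ∷ ys ,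
        ( u≢y uy ∷ All.map (λ far-z u≡z → far-z (inj₁ (sym u≡z))) far
        , uy , All.map (_∘ inj₂) far , path′ ) ,
        end′ , qys

  Consecutive : ℕ → ℕ → Set
  Consecutive i j = suc i ≡ j ⊎ suc j ≡ i

  lookup-injective : ∀ {u ps} → IsInducedPath u ps →
    ∀ i j → lookup (u ∷ ps) i ≡ lookup (u ∷ ps) j → i ≡ j
  lookup-injective _ zero zero _ = refl
  lookup-injective {ps = _ ∷ _} (u∉ , _) zero (suc j) eq =
    contradiction eq (All.lookup u∉ (∈-lookup j))
  lookup-injective {ps = _ ∷ _} (u∉ , _) (suc i) zero eq =
    contradiction (sym eq) (All.lookup u∉ (∈-lookup i))
  lookup-injective {ps = _ ∷ _} (_ , _ , _ , path) (suc i) (suc j) eq =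
    cong suc (lookup-injective path i j eq)

  adj-start⇒toℕ≡1 : ∀ {u ps} → IsInducedPath u ps →
    ∀ j → Adj G u (lookup (u ∷ ps) j) → toℕ j ≡ 1
  adj-start⇒toℕ≡1 _ zero uu = contradiction uu Adj-irrefl
  adj-start⇒toℕ≡1 {ps = _ ∷ _} _ (suc zero) _ = refl
  adj-start⇒toℕ≡1 {ps = _ ∷ _ ∷ _} (_ , _ , nonadj , _) (suc (suc j)) uv =
    contradiction uv (All.lookup nonadj (∈-lookup j))

  adj⇒consecutive : ∀ {u ps} → IsInducedPath u ps → ∀ i j →
    Adj G (lookup (u ∷ ps) i) (lookup (u ∷ ps) j) → Consecutive (toℕ i) (toℕ j)
  adj⇒consecutive path zero j e = inj₁ (sym (adj-start⇒toℕ≡1 path j e))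
  adj⇒consecutive path (suc i) zero e = inj₂ (sym (adj-start⇒toℕ≡1 path (suc i) (Adj-sym e)))
  adj⇒consecutive {ps = _ ∷ _} (_ , _ , _ , path) (suc i) (suc j) e =
    Sum.map (cong suc) (cong suc) (adj⇒consecutive path i j e)

  consecutive⇒adj : ∀ {u ps} → IsInducedPath u ps → ∀ i j →
    Consecutive (toℕ i) (toℕ j) → Adj G (lookup (u ∷ ps) i) (lookup (u ∷ ps) j)
  consecutive⇒adj {ps = _ ∷ _} (_ , uw , _) zero (suc zero) _ = uw
  consecutive⇒adj {ps = _ ∷ _} (_ , uw , _) (suc zero) zero _ = Adj-sym uw
  consecutive⇒adj {ps = _ ∷ _} (_ , _ , _ , path) (suc i) (suc j) c =
    consecutive⇒adj path i j (Sum.map suc-injective suc-injective c)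
  consecutive⇒adj _ zero zero (inj₁ ())
  consecutive⇒adj _ zero zero (inj₂ ())
  consecutive⇒adj {ps = _ ∷ _} _ zero (suc (suc _)) (inj₁ ())
  consecutive⇒adj {ps = _ ∷ _} _ zero (suc (suc _)) (inj₂ ())
  consecutive⇒adj {ps = _ ∷ _} _ (suc (suc _)) zero (inj₁ ())
  consecutive⇒adj {ps = _ ∷ _} _ (suc (suc _)) zero (inj₂ ())

  inducedPath⇒HasInducedPath : ∀ {u ps} → IsInducedPath u ps → HasInducedPath G (suc (length ps))
  inducedPath⇒HasInducedPath {u} {ps} path =
    lookup (u ∷ ps) , lookup-injective path _ _ ,
    λ i j → mk⇔ (adj⇒consecutive path i j) (consecutive⇒adj path i j)

  HasInducedPath-≤ : ∀ {s t} → s ≤ t → HasInducedPath G t → HasInducedPath G s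
  HasInducedPath-≤ s≤t (v , injective , adj⇔) =
    v ∘ restrict , inject≤-injective s≤t s≤t _ _ ∘ injective ,
    λ i j → subst₂ (λ a b → Adj G (v (restrict i)) (v (restrict j)) ⇔ Consecutive a b)
              (toℕ-inject≤ i s≤t) (toℕ-inject≤ j s≤t) (adj⇔ (restrict i) (restrict j))
    where
      restrict = λ i → inject≤ i s≤t

  PathFree⇒2≤t : ∀ {t} → PathFree t G → Vtx G → 2 ≤ t
  PathFree⇒2≤t {t} P-free u with 2 ≤? t
  ... | yes 2≤t = 2≤t
  ... | no 2≰t = ⊥-elim (P-free (HasInducedPath-≤ t≤1 (inducedPath⇒HasInducedPath {u} {[]} tt)))
    where t≤1 = ≤-pred (≰⇒> 2≰t)

  module _ (Level : Vtx G → ℕ → Set)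
           (Level-functional : ∀ {v l l′} → Level v l → Level v l′ → l ≡ l′)
           (Level-lipschitz : ∀ {v w l l′} → Adj G v w → Level v l → Level w l′ → l′ ≤ suc l) where

    walk-length≥level : ∀ {u i L} ws → Walk u ws → Level u i → All (∃ ∘ Level) ws →
      Level (end u ws) L → L ≤ i + length ws
    walk-length≥level {i = i} [] _ lu _ lend =
      ≤-reflexive (trans (Level-functional lend lu) (sym (+-identityʳ i)))
    walk-length≥level {i = i} {L} (w ∷ ws) (uw , walk) lu ((j , lw) ∷ levelled) lend = begin
      L                   ≤⟨ walk-length≥level ws walk lw levelled lend ⟩
      j + length ws       ≤⟨ +-monoˡ-≤ (length ws) (Level-lipschitz uw lu lw) ⟩
      suc i + length ws   ≡⟨ sym (+-suc i (length ws)) ⟩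
      i + suc (length ws) ∎
      where open ≤-Reasoning

module AttachmentChains (G : Graph) (X Y : VSet G) (X∩Y=∅ : Disjoint G X Y) (X-stable : Stable G X)
    {k : ℕ} (Z : Fin k → VSet G) (Z⊆Y : ∀ h → Z h ⊆ Y) where

  open GraphWalks G

  Exclusive : Fin k → Fin k → Vtx G → Set
  Exclusive a b v = v ∈ X × (∀ h → InAttach G X (Z h) v ⇔ (h ≡ a ⊎ h ≡ b))

  module _ {a b v} (ex : Exclusive a b v) where

    Exclusive-attached : ∀ {h} → h ≡ a ⊎ h ≡ b → ∃ λ z → z ∈ Z h × Adj G v z
    Exclusive-attached {h} = proj₂ ∘ Equivalence.from (proj₂ ex h)

    Exclusive-only : ∀ {h} → InAttach G X (Z h) v → h ≡ a ⊎ h ≡ b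
    Exclusive-only {h} = Equivalence.to (proj₂ ex h)

  Exclusive-swap : ∀ {a b v} → Exclusive b a v → Exclusive a b v
  Exclusive-swap (v∈X , attach⇔) = v∈X , λ h →
    mk⇔ (Sum.swap ∘ Equivalence.to (attach⇔ h)) (Equivalence.from (attach⇔ h) ∘ Sum.swap)

  Linked : Fin k → Fin k → Set
  Linked i j = ∃ λ v → ∃ λ w → v ∈ Z i × w ∈ Z j × Reach G Y v w

  Linked-adj : ∀ {i j v w} → v ∈ Z i → w ∈ Z j → Adj G v w → Linked i j
  Linked-adj {i} {j} v∈ w∈ vw = _ , _ , v∈ , w∈ , step (here (Z⊆Y i v∈)) vw (Z⊆Y j w∈)

  Linked-shared : ∀ {i j v} → v ∈ Z i → v ∈ Z j → Linked i j
  Linked-shared {i} v∈ v∈′ = _ , _ , v∈ , v∈′ , here (Z⊆Y i v∈)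

  head-unlinked : ∀ {a As c} → Antichain Linked (a ∷ As) → c ∈ˡ As → ¬ Linked a c
  head-unlinked (a↮ ∷ _) = All.lookup a↮

  head-fresh : ∀ {a As v} → Antichain Linked (a ∷ As) → v ∈ Z a → ¬ a ∈ˡ As
  head-fresh anti v∈ a∈ = head-unlinked anti a∈ (Linked-shared v∈ v∈)

  Z∩X=∅ : ∀ {a v} → v ∈ Z a → ¬ v ∈ X
  Z∩X=∅ {a} v∈ v∈X = X∩Y=∅ _ v∈X (Z⊆Y a v∈)

  data Level : List (Fin k) → Vtx G → ℕ → Set where
    inFirst   : ∀ {a As v} → v ∈ Z a → Level (a ∷ As) v 0
    linkFirst : ∀ {a b As v} → Exclusive a b v → Level (a ∷ b ∷ As) v 1
    later     : ∀ {a As v l} → Level As v l → Level (a ∷ As) v (suc (suc l))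

  Covered : List (Fin k) → Vtx G → Set
  Covered As v = (∃ λ c → c ∈ˡ As × v ∈ Z c) ⊎ (v ∈ X × ∀ h → InAttach G X (Z h) v → h ∈ˡ As)

  level⇒covered : ∀ {As v l} → Level As v l → Covered As v
  level⇒covered (inFirst v∈) = inj₁ (_ , here refl , v∈)
  level⇒covered (linkFirst ex) = inj₂ (proj₁ ex , λ h → firstTwo ∘ Exclusive-only ex)
    where
      firstTwo : ∀ {h a b As} → h ≡ a ⊎ h ≡ b → h ∈ˡ a ∷ b ∷ As
      firstTwo (inj₁ h≡a) = here h≡a
      firstTwo (inj₂ h≡b) = there (here h≡b)
  level⇒covered (later lv) with level⇒covered lv
  ... | inj₁ (c , c∈ , v∈) = inj₁ (c , there c∈ , v∈)
  ... | inj₂ (v∈X , attached) = inj₂ (v∈X , λ h → there ∘ attached h)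

  first∉later : ∀ {a As v l} → Antichain Linked (a ∷ As) → v ∈ Z a → ¬ Level As v l
  first∉later anti v∈ lv with level⇒covered lv
  ... | inj₁ (c , c∈ , v∈′) = head-unlinked anti c∈ (Linked-shared v∈ v∈′)
  ... | inj₂ (v∈X , _) = Z∩X=∅ v∈ v∈X

  link∉later : ∀ {a b As v l} → Antichain Linked (a ∷ b ∷ As) → Exclusive a b v →
    ¬ Level (b ∷ As) v l
  link∉later anti ex lv with level⇒covered lv
  ... | inj₁ (c , _ , v∈) = Z∩X=∅ v∈ (proj₁ ex)
  ... | inj₂ (_ , attached) with Exclusive-attached ex (inj₁ refl)
  ...   | z , z∈ , vz = head-fresh anti z∈ (attached _ (proj₁ ex , z , z∈ , vz))

  level-functional : ∀ {As v l l′} → Antichain Linked As → Level As v l → Level As v l′ → l ≡ l′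
  level-functional _    (inFirst _)    (inFirst _)    = refl
  level-functional _    (linkFirst _)  (linkFirst _)  = refl
  level-functional _    (inFirst v∈)   (linkFirst ex) = contradiction (proj₁ ex) (Z∩X=∅ v∈)
  level-functional _    (linkFirst ex) (inFirst v∈)   = contradiction (proj₁ ex) (Z∩X=∅ v∈)
  level-functional anti (inFirst v∈)   (later lv)     = contradiction lv (first∉later anti v∈)
  level-functional anti (later lv)     (inFirst v∈)   = contradiction lv (first∉later anti v∈)
  level-functional anti (linkFirst ex) (later lv)     = contradiction lv (link∉later anti ex)
  level-functional anti (later lv)     (linkFirst ex) = contradiction lv (link∉later anti ex)
  level-functional (_ ∷ anti) (later lv) (later lv′)  = cong (2 +_) (level-functional anti lv lv′)

  level-lipschitz : ∀ {As v w l l′} → Antichain Linked As →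
    Adj G v w → Level As v l → Level As w l′ → l′ ≤ suc l
  level-lipschitz _ _ _ (inFirst _) = z≤n
  level-lipschitz _ _ (inFirst _) (linkFirst _) = ≤-refl
  level-lipschitz anti vw (inFirst v∈) (later lw) with level⇒covered lw
  ... | inj₁ (c , c∈ , w∈) = contradiction (Linked-adj v∈ w∈ vw) (head-unlinked anti c∈)
  ... | inj₂ (w∈X , attached) =
    contradiction (attached _ (w∈X , _ , v∈ , Adj-sym vw)) (head-fresh anti v∈)
  level-lipschitz _ _ (linkFirst _) (linkFirst _) = s≤s z≤n
  level-lipschitz _ _ (linkFirst _) (later (inFirst _)) = ≤-refl
  level-lipschitz _ vw (linkFirst ex) (later (linkFirst ex′)) =
    ⊥-elim (X-stable _ _ (proj₁ ex) (proj₁ ex′) vw)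
  level-lipschitz anti@(_ ∷ anti′) vw (linkFirst ex) (later (later lw)) with level⇒covered lw
  ... | inj₂ (w∈X , _) = ⊥-elim (X-stable _ _ (proj₁ ex) w∈X vw)
  ... | inj₁ (c , c∈ , w∈) with Exclusive-only ex (proj₁ ex , _ , w∈ , vw)
  ...   | inj₁ refl = contradiction (there c∈) (head-fresh anti w∈)
  ...   | inj₂ refl = contradiction c∈ (head-fresh anti′ w∈)
  level-lipschitz _ _ (later _) (linkFirst _) = s≤s z≤n
  level-lipschitz (_ ∷ anti) vw (later lv) (later lw) = s≤s (s≤s (level-lipschitz anti vw lv lw))

  final : Fin k → List (Fin k) → Fin k
  final a [] = a
  final a (b ∷ As) = final b As

  final-level : ∀ a As {v} → v ∈ Z (final a As) → Level (a ∷ As) v (2 * length As)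
  final-level a [] v∈ = inFirst v∈
  final-level a (b ∷ As) v∈ =
    subst (Level (a ∷ b ∷ As) _) (sym (*-suc 2 (length As))) (later (final-level b As v∈))

  module _ (Z-connected : ∀ h → Connected G (Z h))
           (exclusive : ∀ {a b} → a ≢ b → ∃ (Exclusive a b)) where

    chain-walk : ∀ a As {s} → Antichain Linked (a ∷ As) → s ∈ Z a →
      ∃ λ ws → Walk s ws × All (∃ ∘ Level (a ∷ As)) ws × end s ws ∈ Z (final a As)
    chain-walk a [] _ s∈ = [] , tt , [] , s∈
    chain-walk a (b ∷ As) {s} (a↮ ∷ anti) s∈
      with exclusive (λ { refl → All.head a↮ (Linked-shared s∈ s∈) })
    ... | x , ex
      with Exclusive-attached ex (inj₁ refl) | Exclusive-attached ex (inj₂ refl)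
    ... | y , y∈ , xy | y′ , y′∈ , xy′
      with reach⇒walk (Z-connected a s y s∈ y∈) | chain-walk b As anti y′∈
    ... | r , walk-r , r⊆Za , refl | ws , walk-ws , levelled , end∈ =
      r ++ x ∷ y′ ∷ ws ,
      Walk-++ r walk-r (Adj-sym xy) (xy′ , walk-ws) ,
      All.++⁺ (All.map (λ z∈ → 0 , inFirst z∈) r⊆Za)
              ( (1 , linkFirst ex) ∷ (2 , later (inFirst y′∈))
              ∷ All.map (λ (l , lv) → 2 + l , later lv) levelled) ,
      subst (_∈ Z (final b As)) (sym (end-++ s r x (y′ ∷ ws))) end∈

    antichain⇒inducedPath : ∀ a As {s} → Antichain Linked (a ∷ As) → s ∈ Z a →
      HasInducedPath G (suc (2 * length As))
    antichain⇒inducedPath a As {s} anti s∈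
      with chain-walk a As anti s∈
    ... | ws , walk , levelled , end∈
      with walk⇒inducedPath (∃ ∘ Level (a ∷ As)) s ws walk levelled
    ... | ps , path , end≡ , levelled′ =
      HasInducedPath-≤ (s≤s long) (inducedPath⇒HasInducedPath path)
      where
        long : 2 * length As ≤ length ps
        long = walk-length≥level (Level (a ∷ As)) (level-functional anti) (level-lipschitz anti)
                 ps (IsInducedPath⇒Walk ps path) (inFirst s∈) levelled′
                 (final-level a As (subst (_∈ Z (final a As)) (sym end≡) end∈))

¬¬-decidable : ∀ {k} (R : Fin k → Fin k → Set) → ¬ ¬ (∀ i j → Dec (R i j))
¬¬-decidable R = sequence ¬¬-Applicative λ i → sequence ¬¬-Applicative λ j → ¬¬-excluded-middle
  where open RawMonad ¬¬-Monad using () renaming (rawApplicative to ¬¬-Applicative)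

third-index : ∀ {k} (i j : Fin (3 + k)) → ∃ λ h → h ≢ i × h ≢ j
third-index zero          zero          = suc zero , (λ ()) , (λ ())
third-index zero          (suc zero)    = suc (suc zero) , (λ ()) , (λ ())
third-index zero          (suc (suc _)) = suc zero , (λ ()) , (λ ())
third-index (suc zero)    zero          = suc (suc zero) , (λ ()) , (λ ())
third-index (suc zero)    (suc _)       = zero , (λ ()) , (λ ())
third-index (suc (suc _)) zero          = suc zero , (λ ()) , (λ ())
third-index (suc (suc _)) (suc _)       = zero , (λ ()) , (λ ())

n≤2*⌈n/2⌉ : ∀ n → n ≤ 2 * ⌈ n /2⌉
n≤2*⌈n/2⌉ zero = z≤n
n≤2*⌈n/2⌉ (suc zero) = s≤s z≤n
n≤2*⌈n/2⌉ (suc (suc n)) =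
  subst (suc (suc n) ≤_) (sym (*-suc 2 ⌈ n /2⌉)) (s≤s (s≤s (n≤2*⌈n/2⌉ n)))

module FamilyBound (t p q : ℕ) (G : Graph) (P-free : PathFree t G)
    (X Y : VSet G) (X∩Y=∅ : Disjoint G X Y) (X-stable : Stable G X)
    (components≤p : ComponentsAtMost G Y p) (𝒵 : VSet G → Set)
    (𝒵-shape : ∀ Z → 𝒵 Z → Z ⊆ Y × ∣ Z ∣ ≡ q × Connected G Z × HasAttachmentIn G X Z)
    {k : ℕ} (family : LambdaFamily G X 𝒵 k) where

  open GraphWalks G

  Z : Fin k → VSet G
  Z = proj₁ family

  shape : ∀ h → Z h ⊆ Y × ∣ Z h ∣ ≡ q × Connected G (Z h) × HasAttachmentIn G X (Z h)
  shape h = 𝒵-shape (Z h) (proj₁ (proj₂ family) h)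

  Z⊆Y : ∀ h → Z h ⊆ Y
  Z⊆Y h = proj₁ (shape h)

  ∣Z∣≡q : ∀ h → ∣ Z h ∣ ≡ q
  ∣Z∣≡q h = proj₁ (proj₂ (shape h))

  Z-connected : ∀ h → Connected G (Z h)
  Z-connected h = proj₁ (proj₂ (proj₂ (shape h)))

  point : ∀ h → ∃ (_∈ Z h)
  point h with shape h
  ... | _ , _ , _ , _ , _ , _ , z , z∈ , _ = z , z∈

  open AttachmentChains G X Y X∩Y=∅ X-stable Z Z⊆Y

  exclusive : ∀ {a b} → a ≢ b → ∃ (Exclusive a b)
  exclusive {a} {b} a≢b with Fin.<-cmp a b
  ... | tri< a<b _ _ = proj₂ (proj₂ family) a b a<b
  ... | tri≈ _ a≡b _ = contradiction a≡b a≢b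
  ... | tri> _ _ b<a = map₂ Exclusive-swap (proj₂ (proj₂ family) b a b<a)

  Linked⇒Reach : ∀ {a j v} → Linked a j → v ∈ Z j → Reach G Y (proj₁ (point a)) v
  Linked⇒Reach {a} {j} (x , y , x∈ , y∈ , x⇝y) v∈ =
    Reach-trans (Reach-mono (Z⊆Y a) (Z-connected a _ x (proj₂ (point a)) x∈))
      (Reach-trans x⇝y (Reach-mono (Z⊆Y j) (Z-connected j y _ y∈ v∈)))

  length-linked≤C : ∀ a S → Unique (map Z S) → All (Linked a) S → length S ≤ p C q
  length-linked≤C a S unique linked = begin
    length S          ≡⟨ sym (length-map Z S) ⟩
    length (map Z S)  ≤⟨ length-subsets≤C q D unique
                            (All.map⁺ (All.tabulate λ j∈ → ⊆-⋃ (∈-map⁺ Z j∈) , ∣Z∣≡q _)) ⟩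
    ∣ D ∣ C q          ≤⟨ C-monoˡ-≤ q ∣D∣≤p ⟩
    p C q             ∎
    where
      open ≤-Reasoning
      D = ⋃ (map Z S)
      ∣D∣≤p : ∣ D ∣ ≤ p
      ∣D∣≤p = components≤p _ (Z⊆Y a (proj₂ (point a))) D λ v v∈D →
        let (Zj , Zj∈ , v∈Zj) = ∈-⋃⁻ (map Z S) v∈D
            (j , j∈S , Zj≡) = ∈-map⁻ Z Zj∈
        in Linked⇒Reach (All.lookup linked j∈S) (subst (v ∈_) Zj≡ v∈Zj)

  Z-injective : (∀ i j → ∃ λ h → h ≢ i × h ≢ j) → ∀ {i j} → Z i ≡ Z j → i ≡ j
  Z-injective third {i} {j} Zi≡Zj with i Fin.≟ j
  ... | yes i≡j = i≡j
  ... | no i≢j with third i j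
  ...   | h , h≢i , h≢j with exclusive (h≢i ∘ sym)
  ...     | x , ex with Exclusive-attached ex (inj₁ refl)
  ...       | z , z∈ , xz with Exclusive-only ex (proj₁ ex , z , subst (z ∈_) Zi≡Zj z∈ , xz)
  ...         | inj₁ j≡i = contradiction (sym j≡i) i≢j
  ...         | inj₂ j≡h = contradiction (sym j≡h) h≢j

  bound-if-Linked-decidable : (∀ i j → ∃ λ h → h ≢ i × h ≢ j) → (∀ i j → Dec (Linked i j)) →
    k ≤ (p C q) * ⌈ suc t /2⌉
  bound-if-Linked-decidable third Linked?
    with antichain-or-bounded Linked? (p C q) ⌈ suc t /2⌉ (allFin k) (Unique.allFin⁺ k)
           (λ a S u → length-linked≤C a S (Unique.map⁺ (Z-injective third) u))
  ... | inj₁ (a ∷ As , _ , anti , len) =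
    ⊥-elim (P-free (HasInducedPath-≤ t≤ (antichain⇒inducedPath Z-connected exclusive
                                           a As anti (proj₂ (point a)))))
    where
      t≤ : t ≤ suc (2 * length As)
      t≤ rewrite suc-injective len = ≤-trans (n≤1+n t) (≤-trans (n≤2*⌈n/2⌉ (suc t)) (n≤1+n _))
  ... | inj₂ k≤ = subst₂ _≤_ (length-tabulate id) (*-comm ⌈ suc t /2⌉ (p C q)) k≤

  many-members-bound : (∀ i j → ∃ λ h → h ≢ i × h ≢ j) → k ≤ (p C q) * ⌈ suc t /2⌉
  many-members-bound third =
    decidable-stable (k ≤? _) (¬¬-map (bound-if-Linked-decidable third) (¬¬-decidable Linked))

  two-members-bound : Fin k → 2 ≤ (p C q) * ⌈ suc t /2⌉
  two-members-bound a = *-mono-≤ 1≤pCq 2≤⌈[1+t]/2⌉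
    where
      z∈ = proj₂ (point a)
      1≤pCq = length-linked≤C a (a ∷ []) ([] ∷ []) (Linked-shared z∈ z∈ ∷ [])
      2≤⌈[1+t]/2⌉ = ⌈n/2⌉-mono (s≤s (PathFree⇒2≤t P-free (proj₁ (point a))))

theorem2p5 : (t p q : ℕ) (G : Graph) → PathFree t G →
    (X Y : VSet G) → Disjoint G X Y → Stable G X → ComponentsAtMost G Y p →
    (𝒵 : VSet G → Set) →
    (∀ Z → 𝒵 Z → Z ⊆ Y × ∣ Z ∣ ≡ q × Connected G Z × HasAttachmentIn G X Z) →
    LambdaAtMost G X 𝒵 ((p C q) * ⌈ suc t /2⌉)
theorem2p5 t p q G P-free X Y X∩Y=∅ X-stable components≤p 𝒵 𝒵-shape = λ where
    (suc zero) (s≤s ()) _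
    (suc (suc zero)) _ family → Bound.two-members-bound family zero
    (suc (suc (suc _))) _ family → Bound.many-members-bound family third-index
  where module Bound = FamilyBound t p q G P-free X Y X∩Y=∅ X-stable components≤p 𝒵 𝒵-shape
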